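{- Let $\Sigma$ be a nonempty set containing a fixed element $0$, and write $\bar 0$ for an all-zero tuple. Let $C,\widetilde C$ be $k$-quasigroups and $b,\widetilde b$ be $l$-quasigroups on $\Sigma$. Suppose that for all $\alpha,\delta\in\Sigma$, $\bar\beta\in\Sigma^{l-1}$, $\bar\gamma\in\Sigma^{k-1}$, $$C\langle b(\alpha,\bar 0),\bar\gamma,\delta\rangle\iff\widetilde C\langle\widetilde b(\alpha,\bar 0),\bar\gamma,\delta\rangle\quad\text{and}\quad C\langle b(\alpha,\bar\beta),\bar 0,\delta\rangle\iff\widetilde C\langle\widetilde b(\alpha,\bar\beta),\bar 0,\delta\rangle.$$ Then $C\langle b(\alpha,\bar\beta),\bar\gamma,\delta\rangle\iff\widetilde C\langle\widetilde b(\alpha,\bar\beta),\bar\gamma,\delta\rangle$ for all $\alpha,\delta\in\Sigma$, $\bar\beta\in\Sigma^{l-1}$, $\bar\gamma\in\Sigma^{k-1}$.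
   Context: An $n$-ary operation $q:\Sigma^n\to\Sigma$ is an $n$-quasigroup if in the equality $q(x_1,\ldots,x_n)=x_{n+1}$ knowledge of any $n$ of the elements $x_1,\ldots,x_{n+1}$ uniquely determines the remaining one. Its predicate is the $(n+1)$-ary relation $q\langle x_1,\ldots,x_n,x_{n+1}\rangle:\iff q(x_1,\ldots,x_n)=x_{n+1}$. -}

module Defs where

open import Level using (Level)
open import Data.Nat using (ℕ)
open import Data.Fin using (Fin)
open import Data.Vec using (Vec; _[_]≔_)
open import Data.Product using (Σ; _×_; _,_)
open import Relation.Binary.PropositionalEquality using (_≡_)

Op : ∀ {a} → Set a → ℕ → Set a
Op S n = Vec S n → S

-- n-quasigroup: in q(x₁,…,xₙ) = xₙ₊₁, any n of the n+1 values determine the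
-- remaining one.  xₙ₊₁ is determined by x₁…xₙ since q is a function; the
-- remaining condition: for every position i, every choice of the other
-- arguments (given by x, whose i-th entry is ignored) and every value y,
-- there is a unique z with q(x[i := z]) = y.
IsQuasigroup : ∀ {a} {S : Set a} {n : ℕ} → Op S n → Set a
IsQuasigroup {S = S} {n} q =
  (i : Fin n) (x : Vec S n) (y : S) →
    Σ S λ z → (q (x [ i ]≔ z) ≡ y) × (∀ z′ → q (x [ i ]≔ z′) ≡ y → z′ ≡ z)

Pred⟨_⟩ : ∀ {a} {S : Set a} {n : ℕ} → Op S n → Vec S n → S → Set a
Pred⟨ q ⟩ xs y = q xs ≡ y

-- Every value of b is already attained on the line β = 0̄, so the first
-- hypothesis carries C over to C̃ once we know that b̃ takes the matching value
-- there; that follows from the second hypothesis at γ = 0̄ by cancelling in C̃.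
{-# OPTIONS --safe #-}
module Submission where

open import Defs
open import Data.Nat using (ℕ; suc)
open import Data.Fin using (zero)
open import Data.Vec using (Vec; _∷_; replicate; _[_]≔_)
open import Data.Product using (∃; _,_; proj₁; proj₂)
open import Function.Bundles using (_⇔_; mk⇔; Equivalence)
open import Relation.Binary.PropositionalEquality
  using (_≡_; refl; sym; trans; cong; module ≡-Reasoning)

module _ {S : Set} {n : ℕ} (q : Op S n) (q-quasi : IsQuasigroup q) where

  quasigroup-surjective : ∀ i xs y → ∃ λ z → q (xs [ i ]≔ z) ≡ y
  quasigroup-surjective i xs y = let z , qz≡y , _ = q-quasi i xs y in z , qz≡y

  quasigroup-cancel : ∀ i xs {z z′} → q (xs [ i ]≔ z) ≡ q (xs [ i ]≔ z′) → z ≡ z′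
  quasigroup-cancel i xs {z} {z′} eq =
    let _ , _ , unique = q-quasi i xs (q (xs [ i ]≔ z′))
    in trans (unique z eq) (sym (unique z′ refl))

module _ {a} {A : Set a} {x y : A} where

  ⇔-on-values⇒≡ : (∀ z → x ≡ z ⇔ y ≡ z) → x ≡ y
  ⇔-on-values⇒≡ x≡⇔y≡ = sym (Equivalence.to (x≡⇔y≡ x) refl)

  ≡⇒⇔-on-values : x ≡ y → ∀ z → x ≡ z ⇔ y ≡ z
  ≡⇒⇔-on-values x≡y z = mk⇔ (trans (sym x≡y)) (trans x≡y)

module _ {S : Set} (0S : S) {k l : ℕ} (C C̃ : Op S (suc k)) (b b̃ : Op S (suc l))
         (b-quasi : IsQuasigroup b) (C̃-quasi : IsQuasigroup C̃)
         (agree-at-β₀ : ∀ α γ → C (b (α ∷ replicate l 0S) ∷ γ) ≡ C̃ (b̃ (α ∷ replicate l 0S) ∷ γ))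
         (agree-at-γ₀ : ∀ α β → C (b (α ∷ β) ∷ replicate k 0S) ≡ C̃ (b̃ (α ∷ β) ∷ replicate k 0S))
         where

  open ≡-Reasoning

  0̄ₗ : Vec S l
  0̄ₗ = replicate l 0S

  0̄ₖ : Vec S k
  0̄ₖ = replicate k 0S

  b̃-respects-b-at-β₀ : ∀ {α′ α β} → b (α′ ∷ 0̄ₗ) ≡ b (α ∷ β) → b̃ (α′ ∷ 0̄ₗ) ≡ b̃ (α ∷ β)
  b̃-respects-b-at-β₀ {α′} {α} {β} b≡ = quasigroup-cancel C̃ C̃-quasi zero (0S ∷ 0̄ₖ) (begin
    C̃ (b̃ (α′ ∷ 0̄ₗ) ∷ 0̄ₖ) ≡⟨ sym (agree-at-β₀ α′ 0̄ₖ) ⟩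
    C (b (α′ ∷ 0̄ₗ) ∷ 0̄ₖ)  ≡⟨ cong (λ x → C (x ∷ 0̄ₖ)) b≡ ⟩
    C (b (α ∷ β) ∷ 0̄ₖ)    ≡⟨ agree-at-γ₀ α β ⟩
    C̃ (b̃ (α ∷ β) ∷ 0̄ₖ)    ∎)

  compositions-agree : ∀ α β γ → C (b (α ∷ β) ∷ γ) ≡ C̃ (b̃ (α ∷ β) ∷ γ)
  compositions-agree α β γ = begin
    C (b (α ∷ β) ∷ γ)      ≡⟨ cong (λ x → C (x ∷ γ)) (sym b≡) ⟩
    C (b (α′ ∷ 0̄ₗ) ∷ γ)    ≡⟨ agree-at-β₀ α′ γ ⟩
    C̃ (b̃ (α′ ∷ 0̄ₗ) ∷ γ)    ≡⟨ cong (λ x → C̃ (x ∷ γ)) (b̃-respects-b-at-β₀ b≡) ⟩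
    C̃ (b̃ (α ∷ β) ∷ γ)      ∎
    where
    attained-at-β₀ : ∃ λ α′ → b (α′ ∷ 0̄ₗ) ≡ b (α ∷ β)
    attained-at-β₀ = quasigroup-surjective b b-quasi zero (α ∷ 0̄ₗ) (b (α ∷ β))
    α′ : S
    α′ = proj₁ attained-at-β₀
    b≡ : b (α′ ∷ 0̄ₗ) ≡ b (α ∷ β)
    b≡ = proj₂ attained-at-β₀

lemma4 : (S : Set) (0S : S) (k′ l′ : ℕ)
         (C C̃ : Op S (suc k′)) (b b̃ : Op S (suc l′)) →
         IsQuasigroup C → IsQuasigroup C̃ → IsQuasigroup b → IsQuasigroup b̃ →
         (∀ (α δ : S) (γ : Vec S k′) →
            Pred⟨ C ⟩ (b (α ∷ replicate l′ 0S) ∷ γ) δ ⇔ Pred⟨ C̃ ⟩ (b̃ (α ∷ replicate l′ 0S) ∷ γ) δ) →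
         (∀ (α δ : S) (β : Vec S l′) →
            Pred⟨ C ⟩ (b (α ∷ β) ∷ replicate k′ 0S) δ ⇔ Pred⟨ C̃ ⟩ (b̃ (α ∷ β) ∷ replicate k′ 0S) δ) →
         ∀ (α δ : S) (β : Vec S l′) (γ : Vec S k′) →
           Pred⟨ C ⟩ (b (α ∷ β) ∷ γ) δ ⇔ Pred⟨ C̃ ⟩ (b̃ (α ∷ β) ∷ γ) δ
-- Only b and C̃ need to be quasigroups.
lemma4 S 0S k′ l′ C C̃ b b̃ _ C̃-quasi b-quasi _ at-β₀ at-γ₀ α δ β γ =
  ≡⇒⇔-on-values
    (compositions-agree 0S C C̃ b b̃ b-quasi C̃-quasi
      (λ α′ γ′ → ⇔-on-values⇒≡ (λ δ′ → at-β₀ α′ δ′ γ′))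
      (λ α′ β′ → ⇔-on-values⇒≡ (λ δ′ → at-γ₀ α′ δ′ β′))
      α β γ)
    δ
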